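{- Let $q$ be an odd prime power. Suppose $B=\bigcup_{i \in \mathbb{F}_q \cup \{\infty\}} \ell(i,b_i)$ with $b_i\in\mathbb{F}_q$, and for $P\in\mathbb{F}_q^2$ let $m_P$ be the number of indices $i\in\mathbb{F}_q\cup\{\infty\}$ with $P\in\ell(i,b_i)$. Then, with at most one exception, for every $i \in \mathbb{F}_q\cup \{\infty\}$ there exists a point $P \in \ell(i, b_i)$ with $m_P \geq 3$.
   Context: For $m,b\in\mathbb{F}_q$, $\ell(m,b)$ denotes the line $\{(x,y)\in\mathbb{F}_q^2 : y=mx+b\}$, and for $a\in\mathbb{F}_q$, $\ell(\infty,a)$ denotes the vertical line $\{(x,y): x=a\}$. Here $\mathbb{F}_q$ is the finite field with $q$ elements. -}

module Defs where

open import Level using (0ℓ)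
open import Data.Nat using (ℕ; suc; _≤_; _^_; _%_)
open import Data.Nat.Primality using (Prime)
open import Data.Product using (Σ; ∃; ∃-syntax; _×_; _,_)
open import Data.Maybe using (Maybe; just; nothing)
open import Data.List using (List; length; filter; map; _∷_)
open import Data.List.Membership.Propositional using (_∈_)
open import Data.List.Relation.Unary.Unique.Propositional using (Unique)
open import Relation.Nullary using (¬_; Dec)
open import Relation.Binary.Definitions using (DecidableEquality)
open import Relation.Binary.PropositionalEquality using (_≡_; _≢_)
open import Algebra.Structures using (IsCommutativeRing)

record FiniteField : Set₁ where
  infixl 7 _*_
  infixl 6 _+_
  field
    Carrier : Set
    _+_ _*_ : Carrier → Carrier → Carrier
    -_      : Carrier → Carrier
    0# 1#   : Carrier
    isCommutativeRing : IsCommutativeRing _≡_ _+_ _*_ -_ 0# 1#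
    0≢1     : 0# ≢ 1#
    inverse : ∀ x → x ≢ 0# → ∃[ y ] (x * y ≡ 1#)
    _≟_      : DecidableEquality Carrier
    elements : List Carrier
    elements-unique   : Unique elements
    elements-complete : ∀ x → x ∈ elements

  card : ℕ
  card = length elements

  Point : Set
  Point = Carrier × Carrier

  -- slopes: F_q ∪ {∞}, with ∞ represented by nothing
  Slope : Set
  Slope = Maybe Carrier

  slopes : List Slope
  slopes = nothing ∷ map just elements

  OnLine : Point → Slope → Carrier → Set
  OnLine (x , y) (just m) b = y ≡ m * x + b
  OnLine (x , y) nothing  a = x ≡ a

  onLine? : ∀ P i c → Dec (OnLine P i c)
  onLine? (x , y) (just m) b = y ≟ (m * x + b)
  onLine? (x , y) nothing  a = x ≟ a

  mult : (Slope → Carrier) → Point → ℕ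
  mult b P = length (filter (λ i → onLine? P i (b i)) slopes)

OddPrimePower : ℕ → Set
OddPrimePower q = ∃[ p ] ∃[ k ] (Prime p × p % 2 ≡ 1 × 1 ≤ k × q ≡ p ^ k)

{-# OPTIONS --safe #-}
module Submission where

open import Defs
open import Level using (0ℓ)
open import Function using (id; _∘_)
open import Data.Empty using (⊥-elim)
open import Data.Nat as ℕ using (zero; suc; _≤_; _<_; _≥_; _≤?_; _%_; s≤s; z≤n; z<s)
open import Data.Nat.Properties
  using (≤-refl; ≤-reflexive; ≤-trans; n≤1+n; m<m+n; <⇒≱; 1+n≢0)
open import Data.Nat.DivMod using (%-distribˡ-*; m*n%n≡0)
open import Data.Product as Product using (∃-syntax; _×_; _,_; proj₁; proj₂)
open import Data.Sum using (_⊎_; inj₁; inj₂)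
open import Data.Maybe using (just; nothing)
open import Data.Maybe.Properties using (just-injective)
open import Data.List using (List; []; _∷_; _++_; length; map; filter; foldr; cartesianProduct)
open import Data.List.Properties using (length-++; ++-identityʳ; length-map; map-id)
open import Data.List.Membership.Propositional using (_∈_; lose)
open import Data.List.Membership.Propositional.Properties
  using (∈-∃++; ∈-map⁺; ∈-map⁻; ∈-filter⁺; ∈-filter⁻; ∈-cartesianProduct⁺)
open import Data.List.Relation.Binary.Subset.Propositional using (_⊆_)
open import Data.List.Relation.Unary.Any using (here; there; any?; satisfied)
open import Data.List.Relation.Unary.All as All using (All; []; _∷_)
import Data.List.Relation.Unary.All.Properties as All
open import Data.List.Relation.Unary.AllPairs as AllPairs using ([]; _∷_)
open import Data.List.Relation.Unary.Unique.Propositional using (Unique)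
import Data.List.Relation.Unary.Unique.Propositional.Properties as Unique
open import Data.List.Relation.Binary.Permutation.Propositional
  using (_↭_; ↭-refl; ↭-trans; ↭-sym; prep; ↭⇒↭ₛ)
open import Data.List.Relation.Binary.Permutation.Propositional.Properties
  using (∈-resp-↭; All-resp-↭; ↭-length; shift)
import Data.List.Relation.Binary.Permutation.Setoid.Properties as Permutationₛ
open import Algebra.Bundles using (CommutativeRing)
import Algebra.Properties.Ring as RingProperties
open import Relation.Nullary using (¬_; Dec; yes; no; ¬?; contradiction)
open import Relation.Nullary.Decidable using (map′; _×-dec_)
open import Relation.Binary.PropositionalEquality
  using (_≡_; _≢_; refl; sym; trans; cong; cong₂; subst; setoid; module ≡-Reasoning)
open ≡-Reasoning

-- Suppose neither ℓ(i, b i) nor ℓ(j, b j) contains a point of multiplicity ≥ 3.  Let P₀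
-- be their intersection and e₁, e₂ their directions.  For r ≠ 0 let κ r be the slope
-- of r e₁ − e₂: the line ℓ(κ r, b (κ r)) meets ℓ(i, b i) in P₀ + u(r) e₁ and ℓ(j, b j)
-- in P₀ + v(r) e₂, and since the difference of these points is parallel to r e₁ − e₂,
-- u(r) = r v(r).  As P₀ lies on no third line, u(r) and v(r) are nonzero; as no point
-- of ℓ(i, b i) or ℓ(j, b j) lies on two further lines, u and v are injective.  So u and
-- v permute F*, and multiplying u(r) = r v(r) over F* gives ∏F* = (∏F*)², i.e.
-- ∏F* = 1.  Wilson's theorem says ∏F* = −1, and 1 ≠ −1 because q is odd.

module UniqueLists {a} {A : Set a} where

  Unique-resp-↭ : ∀ {xs ys : List A} → xs ↭ ys → Unique xs → Unique ys
  Unique-resp-↭ σ = Permutationₛ.Unique-resp-↭ (setoid A) (↭⇒↭ₛ σ)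

  ∈⇒↭∷ : ∀ {x : A} {xs} → x ∈ xs → ∃[ ys ] xs ↭ x ∷ ys
  ∈⇒↭∷ x∈xs with ys , zs , refl ← ∈-∃++ x∈xs = ys ++ zs , shift _ ys zs

  ⊆⇒↭++ : ∀ {xs ys : List A} → Unique xs → Unique ys → ys ⊆ xs →
          ∃[ zs ] xs ↭ ys ++ zs
  ⊆⇒↭++ {xs} {[]} _ _ _ = xs , ↭-refl
  ⊆⇒↭++ {xs} {y ∷ ys} xs! (y∉ys ∷ ys!) y∷ys⊆xs with ∈⇒↭∷ (y∷ys⊆xs (here refl))
  ... | xs′ , σ = Product.map₂ (λ τ → ↭-trans σ (prep y τ))
                    (⊆⇒↭++ (AllPairs.tail (Unique-resp-↭ σ xs!)) ys! ys⊆xs′)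
    where
    ys⊆xs′ : ys ⊆ xs′
    ys⊆xs′ z∈ys with ∈-resp-↭ σ (y∷ys⊆xs (there z∈ys))
    ... | here refl   = contradiction refl (All.lookup y∉ys z∈ys)
    ... | there z∈xs′ = z∈xs′

  ⊆∧length⇒↭ : ∀ {xs ys : List A} → Unique xs → Unique ys → ys ⊆ xs →
               length xs ≤ length ys → xs ↭ ys
  ⊆∧length⇒↭ {xs} {ys} xs! ys! ys⊆xs |xs|≤|ys| with ⊆⇒↭++ xs! ys! ys⊆xs
  ... | [] , σ     = subst (xs ↭_) (++-identityʳ ys) σ
  ... | z ∷ zs , σ = contradiction |xs|≤|ys| (<⇒≱ |ys|<|xs|)
    where
    |ys|<|xs| : length ys < length xs
    |ys|<|xs| = subst (length ys <_) (sym (trans (↭-length σ) (length-++ ys)))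
                  (m<m+n (length ys) z<s)

  3≤length : ∀ {xs : List A} {x y z} → Unique xs → x ∈ xs → y ∈ xs → z ∈ xs →
             x ≢ y → x ≢ z → y ≢ z → 3 ≤ length xs
  3≤length xs! x∈xs y∈xs z∈xs x≢y x≢z y≢z
    with ⊆⇒↭++ xs! ((x≢y ∷ x≢z ∷ []) ∷ (y≢z ∷ []) ∷ [] ∷ []) xyz⊆xs
    where
    xyz⊆xs : _ ⊆ _
    xyz⊆xs (here refl)                 = x∈xs
    xyz⊆xs (there (here refl))         = y∈xs
    xyz⊆xs (there (there (here refl))) = z∈xs
  ... | _ , σ = subst (3 ≤_) (sym (↭-length σ)) (s≤s (s≤s (s≤s z≤n)))

  map⁺-local : ∀ {b} {B : Set b} {xs : List A} (f : A → B) →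
               (∀ {x y} → x ∈ xs → y ∈ xs → f x ≡ f y → x ≡ y) →
               Unique xs → Unique (map f xs)
  map⁺-local f inj [] = []
  map⁺-local f inj (x∉xs ∷ xs!) =
    All.map⁺ (All.tabulate λ y∈xs fx≡fy →
               All.lookup x∉xs y∈xs (inj (here refl) (there y∈xs) fx≡fy))
    ∷ map⁺-local f (λ x∈ y∈ → inj (there x∈) (there y∈)) xs!

  pairUp : (A → A) → List A → List A
  pairUp f []       = []
  pairUp f (x ∷ xs) = x ∷ f x ∷ pairUp f xs

  length-pairUp : ∀ f (xs : List A) → length (pairUp f xs) ≡ length xs ℕ.* 2
  length-pairUp f []       = refl
  length-pairUp f (x ∷ xs) = cong (λ n → suc (suc n)) (length-pairUp f xs)

  record FreeInvolutionOn (f : A → A) (xs : List A) : Set a where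
    field
      closed     : ∀ {x} → x ∈ xs → f x ∈ xs
      fixedFree  : ∀ {x} → x ∈ xs → f x ≢ x
      involutive : ∀ {x} → x ∈ xs → f (f x) ≡ x

  module _ {f : A → A} where

    FreeInvolutionOn-resp-↭ : ∀ {xs ys} → xs ↭ ys →
                              FreeInvolutionOn f xs → FreeInvolutionOn f ys
    FreeInvolutionOn-resp-↭ σ inv = record
      { closed     = λ x∈ys → ∈-resp-↭ σ (closed (∈-resp-↭ (↭-sym σ) x∈ys))
      ; fixedFree  = λ x∈ys → fixedFree (∈-resp-↭ (↭-sym σ) x∈ys)
      ; involutive = λ x∈ys → involutive (∈-resp-↭ (↭-sym σ) x∈ys)
      }
      where open FreeInvolutionOn inv

    FreeInvolutionOn-drop : ∀ {x xs} → Unique (x ∷ f x ∷ xs) →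
                            FreeInvolutionOn f (x ∷ f x ∷ xs) → FreeInvolutionOn f xs
    FreeInvolutionOn-drop {x} {xs} ((_ ∷ x∉xs) ∷ fx∉xs ∷ _) inv = record
      { closed     = closed′
      ; fixedFree  = λ z∈xs → fixedFree (there (there z∈xs))
      ; involutive = λ z∈xs → involutive (there (there z∈xs))
      }
      where
      open FreeInvolutionOn inv
      f-swap : ∀ {z y} → z ∈ xs → f z ≡ y → f y ≡ z
      f-swap z∈xs refl = involutive (there (there z∈xs))
      closed′ : ∀ {z} → z ∈ xs → f z ∈ xs
      closed′ z∈xs with closed (there (there z∈xs))
      ... | here fz≡x = contradiction (f-swap z∈xs fz≡x) (All.lookup fx∉xs z∈xs)
      ... | there (here fz≡fx) =
        contradiction (trans (sym (involutive (here refl))) (f-swap z∈xs fz≡fx))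
                      (All.lookup x∉xs z∈xs)
      ... | there (there fz∈xs) = fz∈xs

    FreeInvolutionOn⇒↭pairUp : ∀ {xs} → Unique xs → FreeInvolutionOn f xs →
                               ∃[ ys ] xs ↭ pairUp f ys
    FreeInvolutionOn⇒↭pairUp {xs} = go (length xs) ≤-refl
      where
      go : ∀ n {xs} → length xs ≤ n → Unique xs → FreeInvolutionOn f xs →
           ∃[ ys ] xs ↭ pairUp f ys
      go _ {[]} _ _ _ = [] , ↭-refl
      go (suc n) {x ∷ xs} (s≤s |xs|≤n) xs! inv with FreeInvolutionOn.closed inv (here refl)
      ... | here fx≡x = contradiction fx≡x (FreeInvolutionOn.fixedFree inv (here refl))
      ... | there fx∈xs with xs′ , τ ← ∈⇒↭∷ fx∈xs =
        Product.map (x ∷_) (λ ρ → ↭-trans σ (prep x (prep (f x) ρ)))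
          (go n |xs′|≤n (AllPairs.tail (AllPairs.tail xfx∷xs′!))
               (FreeInvolutionOn-drop xfx∷xs′! (FreeInvolutionOn-resp-↭ σ inv)))
        where
        σ : x ∷ xs ↭ x ∷ f x ∷ xs′
        σ = prep x τ
        xfx∷xs′! : Unique (x ∷ f x ∷ xs′)
        xfx∷xs′! = Unique-resp-↭ σ xs!
        |xs′|≤n : length xs′ ≤ n
        |xs′|≤n = ≤-trans (n≤1+n (length xs′)) (subst (_≤ n) (↭-length τ) |xs|≤n)

oddPrimePower⇒odd : ∀ {q} → OddPrimePower q → q % 2 ≡ 1
oddPrimePower⇒odd (p , k , _ , p%2≡1 , _ , refl) = ^-odd k
  where
  ^-odd : ∀ k → p ℕ.^ k % 2 ≡ 1
  ^-odd zero    = refl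
  ^-odd (suc k) = trans (%-distribˡ-* p (p ℕ.^ k) 2)
                        (cong₂ (λ m n → m ℕ.* n % 2) p%2≡1 (^-odd k))

module FieldProperties (F : FiniteField) where
  open FiniteField F

  commutativeRing : CommutativeRing 0ℓ 0ℓ
  commutativeRing = record { isCommutativeRing = isCommutativeRing }

  open CommutativeRing commutativeRing public
    using ( +-assoc; +-comm; +-identityʳ; -‿inverseʳ
          ; *-assoc; *-comm; *-identityˡ; *-identityʳ; zeroˡ; zeroʳ
          ; distribˡ; *-isCommutativeMonoid )
  open RingProperties (CommutativeRing.ring commutativeRing) public
    using ( -‿involutive; -‿+-comm; -‿distribʳ-*; -0#≈0#; -1*x≈-x
          ; x∙y⁻¹≈ε⇒x≈y; +-identityʳ-unique; //-rightDividesˡ )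
  open import Algebra.Solver.Ring.NaturalCoefficients.Default
    (CommutativeRing.commutativeSemiring commutativeRing) public

  1≢0 : 1# ≢ 0#
  1≢0 1≡0 = 0≢1 (sym 1≡0)

  -1≢0 : - 1# ≢ 0#
  -1≢0 -1≡0 = 1≢0 (begin
    1#           ≡⟨ +-identityʳ 1# ⟨
    1# + 0#      ≡⟨ cong (1# +_) -1≡0 ⟨
    1# + - 1#    ≡⟨ -‿inverseʳ 1# ⟩
    0#           ∎)

  [-1]²≡1 : - 1# * - 1# ≡ 1#
  [-1]²≡1 = trans (-1*x≈-x (- 1#)) (-‿involutive 1#)

  infix 8 _⁻¹
  _⁻¹ : Carrier → Carrier
  x ⁻¹ with x ≟ 0#
  ... | yes _  = 0#
  ... | no x≢0 = proj₁ (inverse x x≢0)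

  ⁻¹-inverseʳ : ∀ {x} → x ≢ 0# → x * x ⁻¹ ≡ 1#
  ⁻¹-inverseʳ {x} x≢0 with x ≟ 0#
  ... | yes x≡0 = contradiction x≡0 x≢0
  ... | no x≢0′ = proj₂ (inverse x x≢0′)

  ⁻¹-inverseˡ : ∀ {x} → x ≢ 0# → x ⁻¹ * x ≡ 1#
  ⁻¹-inverseˡ {x} x≢0 = trans (*-comm (x ⁻¹) x) (⁻¹-inverseʳ x≢0)

  *-cancelʳ : ∀ {x y z} → z ≢ 0# → x * z ≡ y * z → x ≡ y
  *-cancelʳ {x} {y} {z} z≢0 xz≡yz = begin
    x                ≡⟨ *-identityʳ x ⟨
    x * 1#           ≡⟨ cong (x *_) (⁻¹-inverseʳ z≢0) ⟨
    x * (z * z ⁻¹)   ≡⟨ *-assoc x z (z ⁻¹) ⟨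
    x * z * z ⁻¹     ≡⟨ cong (_* z ⁻¹) xz≡yz ⟩
    y * z * z ⁻¹     ≡⟨ *-assoc y z (z ⁻¹) ⟩
    y * (z * z ⁻¹)   ≡⟨ cong (y *_) (⁻¹-inverseʳ z≢0) ⟩
    y * 1#           ≡⟨ *-identityʳ y ⟩
    y                ∎

  *-≢0 : ∀ {x y} → x ≢ 0# → y ≢ 0# → x * y ≢ 0#
  *-≢0 {x} {y} x≢0 y≢0 xy≡0 = x≢0 (*-cancelʳ y≢0 (trans xy≡0 (sym (zeroˡ y))))

  ⁻¹-≢0 : ∀ {x} → x ≢ 0# → x ⁻¹ ≢ 0#
  ⁻¹-≢0 {x} x≢0 x⁻¹≡0 = 1≢0 (begin
    1#          ≡⟨ ⁻¹-inverseʳ x≢0 ⟨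
    x * x ⁻¹    ≡⟨ cong (x *_) x⁻¹≡0 ⟩
    x * 0#      ≡⟨ zeroʳ x ⟩
    0#          ∎)

  ⁻¹-unique : ∀ {x y} → x * y ≡ 1# → x ⁻¹ ≡ y
  ⁻¹-unique {x} {y} xy≡1 = *-cancelʳ x≢0 (begin
    x ⁻¹ * x    ≡⟨ ⁻¹-inverseˡ x≢0 ⟩
    1#          ≡⟨ xy≡1 ⟨
    x * y       ≡⟨ *-comm x y ⟩
    y * x       ∎)
    where
    x≢0 : x ≢ 0#
    x≢0 x≡0 = 1≢0 (trans (sym xy≡1) (trans (cong (_* y) x≡0) (zeroˡ y)))

  ⁻¹-involutive : ∀ {x} → x ≢ 0# → x ⁻¹ ⁻¹ ≡ x
  ⁻¹-involutive x≢0 = ⁻¹-unique (⁻¹-inverseˡ x≢0)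

  x²≡1⇒x≡±1 : ∀ {x} → x * x ≡ 1# → x ≡ 1# ⊎ x ≡ - 1#
  x²≡1⇒x≡±1 {x} x²≡1 with (x + 1#) ≟ 0#
  ... | yes x+1≡0 =
    inj₂ (x∙y⁻¹≈ε⇒x≈y x (- 1#) (trans (cong (x +_) (-‿involutive 1#)) x+1≡0))
  ... | no x+1≢0 = inj₁ (*-cancelʳ x+1≢0 (begin
    x * (x + 1#)    ≡⟨ solve 1 (λ x → x :* (x :+ con 1) := x :* x :+ x) refl x ⟩
    x * x + x       ≡⟨ cong (_+ x) x²≡1 ⟩
    1# + x          ≡⟨ solve 1 (λ x → con 1 :+ x := con 1 :* (x :+ con 1)) refl x ⟩
    1# * (x + 1#)   ∎))

  ⁻¹-fixed⇒±1 : ∀ {x} → x ≢ 0# → x ⁻¹ ≡ x → x ≡ 1# ⊎ x ≡ - 1#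
  ⁻¹-fixed⇒±1 {x} x≢0 x⁻¹≡x =
    x²≡1⇒x≡±1 (trans (cong (x *_) (sym x⁻¹≡x)) (⁻¹-inverseʳ x≢0))

  x⁻¹≡c⇒x≡c : ∀ {x c} → x ≢ 0# → c * c ≡ 1# → x ⁻¹ ≡ c → x ≡ c
  x⁻¹≡c⇒x≡c {x} {c} x≢0 c²≡1 x⁻¹≡c = begin
    x          ≡⟨ ⁻¹-involutive x≢0 ⟨
    x ⁻¹ ⁻¹    ≡⟨ cong _⁻¹ x⁻¹≡c ⟩
    c ⁻¹       ≡⟨ ⁻¹-unique c²≡1 ⟩
    c          ∎

module Products (F : FiniteField) where
  open FiniteField F
  open FieldProperties F
  open UniqueLists

  ∏ : List Carrier → Carrier
  ∏ = foldr _*_ 1#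

  ∏-↭ : ∀ {xs ys} → xs ↭ ys → ∏ xs ≡ ∏ ys
  ∏-↭ σ = Permutationₛ.foldr-commMonoid (setoid Carrier) *-isCommutativeMonoid (↭⇒↭ₛ σ)

  ∏-map-* : ∀ {xs} (f g h : Carrier → Carrier) → All (λ x → h x ≡ f x * g x) xs →
            ∏ (map h xs) ≡ ∏ (map f xs) * ∏ (map g xs)
  ∏-map-* f g h [] = sym (*-identityʳ 1#)
  ∏-map-* {x ∷ xs} f g h (hx≡fx*gx ∷ eqs) = begin
    h x * ∏ (map h xs)
      ≡⟨ cong₂ _*_ hx≡fx*gx (∏-map-* f g h eqs) ⟩
    f x * g x * (∏ (map f xs) * ∏ (map g xs))
      ≡⟨ solve 4 (λ a b c d → a :* b :* (c :* d) := a :* c :* (b :* d)) refl (f x) (g x) _ _ ⟩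
    f x * ∏ (map f xs) * (g x * ∏ (map g xs))
      ∎

  ∏-≢0 : ∀ {xs} → All (_≢ 0#) xs → ∏ xs ≢ 0#
  ∏-≢0 []             = 1≢0
  ∏-≢0 (x≢0 ∷ xs≢0) = *-≢0 x≢0 (∏-≢0 xs≢0)

  ∏-pairUp-⁻¹ : ∀ ys → All (_≢ 0#) (pairUp _⁻¹ ys) → ∏ (pairUp _⁻¹ ys) ≡ 1#
  ∏-pairUp-⁻¹ [] _ = refl
  ∏-pairUp-⁻¹ (y ∷ ys) (y≢0 ∷ _ ∷ rest≢0) = begin
    y * (y ⁻¹ * ∏ (pairUp _⁻¹ ys))   ≡⟨ *-assoc y (y ⁻¹) _ ⟨
    y * y ⁻¹ * ∏ (pairUp _⁻¹ ys)     ≡⟨ cong₂ _*_ (⁻¹-inverseʳ y≢0) (∏-pairUp-⁻¹ ys rest≢0) ⟩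
    1# * 1#                          ≡⟨ *-identityʳ 1# ⟩
    1#                               ∎

  units : List Carrier
  units = filter (λ x → ¬? (x ≟ 0#)) elements

  units! : Unique units
  units! = Unique.filter⁺ (λ x → ¬? (x ≟ 0#)) elements-unique

  ∈-units⁺ : ∀ {x} → x ≢ 0# → x ∈ units
  ∈-units⁺ {x} = ∈-filter⁺ (λ x → ¬? (x ≟ 0#)) (elements-complete x)

  ∈-units⁻ : ∀ {x} → x ∈ units → x ≢ 0#
  ∈-units⁻ x∈units = proj₂ (∈-filter⁻ (λ x → ¬? (x ≟ 0#)) {xs = elements} x∈units)

  ∏-map-units : (f : Carrier → Carrier) → (∀ {x} → x ≢ 0# → f x ≢ 0#) →
                (∀ {x y} → x ≢ 0# → y ≢ 0# → f x ≡ f y → x ≡ y) →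
                ∏ (map f units) ≡ ∏ units
  ∏-map-units f f≢0 f-injective =
    sym (∏-↭ (⊆∧length⇒↭ units! f[units]! f[units]⊆units
                (≤-reflexive (sym (length-map f units)))))
    where
    f[units]! : Unique (map f units)
    f[units]! = map⁺-local f (λ x∈ y∈ → f-injective (∈-units⁻ x∈) (∈-units⁻ y∈)) units!
    f[units]⊆units : ∀ {y} → y ∈ map f units → y ∈ units
    f[units]⊆units y∈ with x , x∈ , refl ← ∈-map⁻ f y∈ = ∈-units⁺ (f≢0 (∈-units⁻ x∈))

  -- If 1 ≡ -1 then x ↦ x + 1 is a fixed-point-free involution of F, so q is even.
  odd-card⇒1≢-1 : card % 2 ≡ 1 → 1# ≢ - 1#
  odd-card⇒1≢-1 card-odd 1≡-1
    with FreeInvolutionOn⇒↭pairUp elements-unique +1-on-elements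
    where
    +1-on-elements : FreeInvolutionOn (_+ 1#) elements
    +1-on-elements = record
      { closed     = λ _ → elements-complete _
      ; fixedFree  = λ {x} _ x+1≡x → 1≢0 (+-identityʳ-unique x 1# x+1≡x)
      ; involutive = λ {x} _ → begin
          x + 1# + 1#      ≡⟨ +-assoc x 1# 1# ⟩
          x + (1# + 1#)    ≡⟨ cong (λ y → x + (1# + y)) 1≡-1 ⟩
          x + (1# + - 1#)  ≡⟨ cong (x +_) (-‿inverseʳ 1#) ⟩
          x + 0#           ≡⟨ +-identityʳ x ⟩
          x                ∎
      }
  ... | ys , σ = 1+n≢0 (begin
    1                     ≡⟨ card-odd ⟨
    card % 2              ≡⟨ cong (_% 2) (trans (↭-length σ) (length-pairUp (_+ 1#) ys)) ⟩
    length ys ℕ.* 2 % 2   ≡⟨ m*n%n≡0 (length ys) 2 ⟩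
    0                     ∎)

  -- Wilson: ±1 are the only self-inverse units; the others pair off with their inverses.
  ∏-units≡-1 : 1# ≢ - 1# → ∏ units ≡ - 1#
  ∏-units≡-1 1≢-1 with ⊆⇒↭++ units! ((1≢-1 ∷ []) ∷ [] ∷ []) ±1⊆units
    where
    ±1⊆units : ∀ {x} → x ∈ 1# ∷ - 1# ∷ [] → x ∈ units
    ±1⊆units (here refl)         = ∈-units⁺ 1≢0
    ±1⊆units (there (here refl)) = ∈-units⁺ -1≢0
  ... | rest , σ = begin
    ∏ units                ≡⟨ ∏-↭ σ ⟩
    1# * (- 1# * ∏ rest)   ≡⟨ *-identityˡ _ ⟩
    - 1# * ∏ rest          ≡⟨ cong (- 1# *_) ∏rest≡1 ⟩
    - 1# * 1#              ≡⟨ *-identityʳ (- 1#) ⟩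
    - 1#                   ∎
    where
    ±1∷rest! : Unique (1# ∷ - 1# ∷ rest)
    ±1∷rest! = Unique-resp-↭ σ units!
    rest! : Unique rest
    rest! = AllPairs.tail (AllPairs.tail ±1∷rest!)
    1≢rest : ∀ {x} → x ∈ rest → 1# ≢ x
    1≢rest x∈rest = All.lookup (AllPairs.head ±1∷rest!) (there x∈rest)
    -1≢rest : ∀ {x} → x ∈ rest → - 1# ≢ x
    -1≢rest x∈rest = All.lookup (AllPairs.head (AllPairs.tail ±1∷rest!)) x∈rest
    rest≢0 : ∀ {x} → x ∈ rest → x ≢ 0#
    rest≢0 x∈rest = ∈-units⁻ (∈-resp-↭ (↭-sym σ) (there (there x∈rest)))
    ⁻¹-closed : ∀ {x} → x ∈ rest → x ⁻¹ ∈ rest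
    ⁻¹-closed {x} x∈rest with ∈-resp-↭ σ (∈-units⁺ (⁻¹-≢0 (rest≢0 x∈rest)))
    ... | here x⁻¹≡1 =
      contradiction (sym (x⁻¹≡c⇒x≡c (rest≢0 x∈rest) (*-identityʳ 1#) x⁻¹≡1)) (1≢rest x∈rest)
    ... | there (here x⁻¹≡-1) =
      contradiction (sym (x⁻¹≡c⇒x≡c (rest≢0 x∈rest) [-1]²≡1 x⁻¹≡-1)) (-1≢rest x∈rest)
    ... | there (there x⁻¹∈rest) = x⁻¹∈rest
    ⁻¹-fixedFree : ∀ {x} → x ∈ rest → x ⁻¹ ≢ x
    ⁻¹-fixedFree x∈rest x⁻¹≡x with ⁻¹-fixed⇒±1 (rest≢0 x∈rest) x⁻¹≡x
    ... | inj₁ x≡1  = 1≢rest x∈rest (sym x≡1)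
    ... | inj₂ x≡-1 = -1≢rest x∈rest (sym x≡-1)
    ⁻¹-on-rest : FreeInvolutionOn _⁻¹ rest
    ⁻¹-on-rest = record
      { closed     = ⁻¹-closed
      ; fixedFree  = ⁻¹-fixedFree
      ; involutive = λ x∈rest → ⁻¹-involutive (rest≢0 x∈rest)
      }
    ∏rest≡1 : ∏ rest ≡ 1#
    ∏rest≡1 with ys , τ ← FreeInvolutionOn⇒↭pairUp rest! ⁻¹-on-rest =
      trans (∏-↭ τ) (∏-pairUp-⁻¹ ys (All-resp-↭ τ (All.tabulate rest≢0)))

module Plane (F : FiniteField) where
  open FiniteField F
  open FieldProperties F

  -- ℓ(k, c) is the level set form k ≡ c of a linear form whose kernel is spanned by dir k.
  form : Slope → Point → Carrier
  form (just m) (x , y) = y + - (m * x)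
  form nothing  (x , _) = x

  form⇒onLine : ∀ {P} k {c} → form k P ≡ c → OnLine P k c
  form⇒onLine {x , y} (just m) {c} form≡c = begin
    y                        ≡⟨ //-rightDividesˡ (m * x) y ⟨
    y + - (m * x) + m * x    ≡⟨ cong (_+ m * x) form≡c ⟩
    c + m * x                ≡⟨ +-comm c (m * x) ⟩
    m * x + c                ∎
  form⇒onLine nothing x≡c = x≡c

  infixl 6 _+ᵥ_
  infixl 7 _·ᵥ_

  _+ᵥ_ : Point → Point → Point
  (x , y) +ᵥ (x′ , y′) = x + x′ , y + y′

  _·ᵥ_ : Carrier → Point → Point
  t ·ᵥ (x , y) = t * x , t * y

  form-+ᵥ : ∀ k P Q → form k (P +ᵥ Q) ≡ form k P + form k Q
  form-+ᵥ (just m) (x , y) (x′ , y′) = begin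
    y + y′ + - (m * (x + x′))
      ≡⟨ cong (λ z → y + y′ + - z) (distribˡ m x x′) ⟩
    y + y′ + - (m * x + m * x′)
      ≡⟨ cong (y + y′ +_) (-‿+-comm (m * x) (m * x′)) ⟨
    y + y′ + (- (m * x) + - (m * x′))
      ≡⟨ solve 4 (λ y y′ a a′ → y :+ y′ :+ (a :+ a′) := y :+ a :+ (y′ :+ a′))
                 refl y y′ (- (m * x)) (- (m * x′)) ⟩
    y + - (m * x) + (y′ + - (m * x′))
      ∎
  form-+ᵥ nothing _ _ = refl

  form-·ᵥ : ∀ k t P → form k (t ·ᵥ P) ≡ t * form k P
  form-·ᵥ (just m) t (x , y) = begin
    t * y + - (m * (t * x))
      ≡⟨ cong (λ z → t * y + - z) (solve 3 (λ m t x → m :* (t :* x) := t :* (m :* x)) refl m t x) ⟩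
    t * y + - (t * (m * x))
      ≡⟨ cong (t * y +_) (-‿distribʳ-* t (m * x)) ⟩
    t * y + t * - (m * x)
      ≡⟨ distribˡ t y (- (m * x)) ⟨
    t * (y + - (m * x))
      ∎
  form-·ᵥ nothing _ _ = refl

  dir : Slope → Point
  dir (just m) = 1# , m
  dir nothing  = 0# , 1#

  form-dir : ∀ k → form k (dir k) ≡ 0#
  form-dir (just m) = trans (cong (λ z → m + - z) (*-identityʳ m)) (-‿inverseʳ m)
  form-dir nothing  = refl

  form-dir-≢0 : ∀ {a k} → a ≢ k → form k (dir a) ≢ 0#
  form-dir-≢0 {just m′} {just m} m′≢m form≡0 =
    m′≢m (cong just (trans (x∙y⁻¹≈ε⇒x≈y m′ (m * 1#) form≡0) (*-identityʳ m)))
  form-dir-≢0 {nothing} {just m} _ form≡0 = 1≢0 (begin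
    1#               ≡⟨ +-identityʳ 1# ⟨
    1# + 0#          ≡⟨ cong (1# +_) -0#≈0# ⟨
    1# + - 0#        ≡⟨ cong (λ z → 1# + - z) (zeroʳ m) ⟨
    1# + - (m * 0#)  ≡⟨ form≡0 ⟩
    0#               ∎)
  form-dir-≢0 {just _}  {nothing} _ = 1≢0
  form-dir-≢0 {nothing} {nothing} nothing≢nothing = contradiction refl nothing≢nothing

  slopeOf : Point → Slope
  slopeOf (x , y) with x ≟ 0#
  ... | yes _ = nothing
  ... | no _  = just (y * x ⁻¹)

  form-slopeOf : ∀ P → form (slopeOf P) P ≡ 0#
  form-slopeOf (x , y) with x ≟ 0#
  ... | yes x≡0 = x≡0
  ... | no x≢0  = begin
    y + - (y * x ⁻¹ * x)    ≡⟨ cong (λ z → y + - z) (*-assoc y (x ⁻¹) x) ⟩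
    y + - (y * (x ⁻¹ * x))  ≡⟨ cong (λ z → y + - (y * z)) (⁻¹-inverseˡ x≢0) ⟩
    y + - (y * 1#)          ≡⟨ cong (λ z → y + - z) (*-identityʳ y) ⟩
    y + - y                 ≡⟨ -‿inverseʳ y ⟩
    0#                      ∎

  basePoint : Slope → Carrier → Point
  basePoint (just _) c = 0# , c
  basePoint nothing  c = c , 0#

  form-basePoint : ∀ k c → form k (basePoint k c) ≡ c
  form-basePoint (just m) c = begin
    c + - (m * 0#)   ≡⟨ cong (λ z → c + - z) (zeroʳ m) ⟩
    c + - 0#         ≡⟨ cong (c +_) -0#≈0# ⟩
    c + 0#           ≡⟨ +-identityʳ c ⟩
    c                ∎
  form-basePoint nothing c = refl

  hit : Slope → Slope → Carrier → Point → Carrier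
  hit a k c B = (c + - form k B) * form k (dir a) ⁻¹

  meet : Slope → Slope → Carrier → Point → Point
  meet a k c B = B +ᵥ hit a k c B ·ᵥ dir a

  form-along : ∀ k a t B → form k (B +ᵥ t ·ᵥ dir a) ≡ form k B + t * form k (dir a)
  form-along k a t B =
    trans (form-+ᵥ k B (t ·ᵥ dir a)) (cong (form k B +_) (form-·ᵥ k t (dir a)))

  form-meet-self : ∀ a k c B → form a (meet a k c B) ≡ form a B
  form-meet-self a k c B = begin
    form a (meet a k c B)               ≡⟨ form-along a a t B ⟩
    form a B + t * form a (dir a)       ≡⟨ cong (λ z → form a B + t * z) (form-dir a) ⟩
    form a B + t * 0#                   ≡⟨ cong (form a B +_) (zeroʳ t) ⟩
    form a B + 0#                       ≡⟨ +-identityʳ _ ⟩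
    form a B                            ∎
    where t = hit a k c B

  module _ {a k : Slope} (a≢k : a ≢ k) (c : Carrier) (B : Point) where

    hit-spec : hit a k c B * form k (dir a) ≡ c + - form k B
    hit-spec = begin
      g * d ⁻¹ * d      ≡⟨ *-assoc g (d ⁻¹) d ⟩
      g * (d ⁻¹ * d)    ≡⟨ cong (g *_) (⁻¹-inverseˡ (form-dir-≢0 a≢k)) ⟩
      g * 1#            ≡⟨ *-identityʳ g ⟩
      g                 ∎
      where
      g = c + - form k B
      d = form k (dir a)

    form-meet : form k (meet a k c B) ≡ c
    form-meet = begin
      form k (meet a k c B)                     ≡⟨ form-along k a (hit a k c B) B ⟩
      form k B + hit a k c B * form k (dir a)   ≡⟨ cong (form k B +_) hit-spec ⟩
      form k B + (c + - form k B)               ≡⟨ +-comm (form k B) _ ⟩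
      c + - form k B + form k B                 ≡⟨ //-rightDividesˡ (form k B) c ⟩
      c                                         ∎

    hit≡0⇒form≡ : hit a k c B ≡ 0# → form k B ≡ c
    hit≡0⇒form≡ hit≡0 = sym (x∙y⁻¹≈ε⇒x≈y c (form k B) (begin
      c + - form k B                  ≡⟨ hit-spec ⟨
      hit a k c B * form k (dir a)    ≡⟨ cong (_* form k (dir a)) hit≡0 ⟩
      0# * form k (dir a)             ≡⟨ zeroˡ _ ⟩
      0#                              ∎))

module Family (F : FiniteField) (b : FiniteField.Slope F → FiniteField.Carrier F) where
  open FiniteField F
  open FieldProperties F
  open Products F
  open Plane F
  open UniqueLists

  Rich : Slope → Set
  Rich k = ∃[ P ] (OnLine P k (b k) × mult b P ≥ 3)

  points : List Point
  points = cartesianProduct elements elements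

  rich? : ∀ k → Dec (Rich k)
  rich? k = map′ satisfied (λ (P , rich-at-P) → lose (∈-points P) rich-at-P)
                 (any? (λ P → onLine? P k (b k) ×-dec (3 ≤? mult b P)) points)
    where
    ∈-points : ∀ P → P ∈ points
    ∈-points (x , y) = ∈-cartesianProduct⁺ (elements-complete x) (elements-complete y)

  slopes! : Unique slopes
  slopes! = All.map⁺ (All.tabulate λ _ ()) ∷ Unique.map⁺ just-injective elements-unique

  ∈-slopes : ∀ k → k ∈ slopes
  ∈-slopes nothing  = here refl
  ∈-slopes (just m) = there (∈-map⁺ just (elements-complete m))

  infix 4 _∈ℓ_
  _∈ℓ_ : Point → Slope → Set
  P ∈ℓ k = form k P ≡ b k

  concurrent⇒rich : ∀ {P k k₁ k₂} → P ∈ℓ k → P ∈ℓ k₁ → P ∈ℓ k₂ →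
                    k ≢ k₁ → k ≢ k₂ → k₁ ≢ k₂ → Rich k
  concurrent⇒rich {P} {k} P∈k P∈k₁ P∈k₂ k≢k₁ k≢k₂ k₁≢k₂ =
    P , form⇒onLine k P∈k ,
    3≤length (Unique.filter⁺ on? slopes!) (through P∈k) (through P∈k₁) (through P∈k₂)
             k≢k₁ k≢k₂ k₁≢k₂
    where
    on? : ∀ i → Dec (OnLine P i (b i))
    on? i = onLine? P i (b i)
    through : ∀ {i} → P ∈ℓ i → i ∈ filter on? slopes
    through {i} P∈i = ∈-filter⁺ on? (∈-slopes i) (form⇒onLine i P∈i)

  module TwoPoorLines {i j : Slope} (i≢j : i ≢ j) (¬rich-i : ¬ Rich i) (¬rich-j : ¬ Rich j)
    where

    e₁ e₂ : Point
    e₁ = dir i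
    e₂ = dir j

    P₀ : Point
    P₀ = meet i j (b j) (basePoint i (b i))

    P₀∈i : P₀ ∈ℓ i
    P₀∈i = trans (form-meet-self i j (b j) _) (form-basePoint i (b i))

    P₀∈j : P₀ ∈ℓ j
    P₀∈j = form-meet i≢j (b j) _

    κ : Carrier → Slope
    κ r = slopeOf (r ·ᵥ e₁ +ᵥ (- 1#) ·ᵥ e₂)

    form-κ : ∀ {r k} → k ≡ κ r → form k e₂ ≡ r * form k e₁
    form-κ {r} refl = sym (x∙y⁻¹≈ε⇒x≈y _ _ (begin
      r * form (κ r) e₁ + - form (κ r) e₂
        ≡⟨ cong (r * form (κ r) e₁ +_) (-1*x≈-x _) ⟨
      r * form (κ r) e₁ + - 1# * form (κ r) e₂
        ≡⟨ cong₂ _+_ (form-·ᵥ (κ r) r e₁) (form-·ᵥ (κ r) (- 1#) e₂) ⟨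
      form (κ r) (r ·ᵥ e₁) + form (κ r) (- 1# ·ᵥ e₂)
        ≡⟨ form-+ᵥ (κ r) _ _ ⟨
      form (κ r) (r ·ᵥ e₁ +ᵥ (- 1#) ·ᵥ e₂)
        ≡⟨ form-slopeOf _ ⟩
      0#
        ∎))

    κ≢i : ∀ r → i ≢ κ r
    κ≢i r i≡κr = form-dir-≢0 (i≢j ∘ sym) (begin
      form i e₂         ≡⟨ form-κ i≡κr ⟩
      r * form i e₁     ≡⟨ cong (r *_) (form-dir i) ⟩
      r * 0#            ≡⟨ zeroʳ r ⟩
      0#                ∎)

    κ≢j : ∀ {r} → r ≢ 0# → j ≢ κ r
    κ≢j {r} r≢0 j≡κr =
      *-≢0 r≢0 (form-dir-≢0 i≢j) (trans (sym (form-κ j≡κr)) (form-dir j))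

    κ-injective : ∀ {r r′} → κ r ≡ κ r′ → r ≡ r′
    κ-injective {r} κr≡κr′ =
      *-cancelʳ (form-dir-≢0 (κ≢i r)) (trans (sym (form-κ refl)) (form-κ κr≡κr′))

    P₀∉κ : ∀ {r} → r ≢ 0# → ¬ P₀ ∈ℓ κ r
    P₀∉κ {r} r≢0 P₀∈κr =
      ¬rich-i (concurrent⇒rich P₀∈i P₀∈j P₀∈κr i≢j (κ≢i r) (κ≢j r≢0))

    -- P₀ + cut a r · dir a is where the line through P₀ of slope a meets ℓ(κ r, b (κ r));
    -- cut i and cut j are the maps u and v.
    cut : Slope → Carrier → Carrier
    cut a r = hit a (κ r) (b (κ r)) P₀

    cut-≢0 : ∀ {a r} → a ≢ κ r → r ≢ 0# → cut a r ≢ 0#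
    cut-≢0 a≢κr r≢0 cut≡0 = P₀∉κ r≢0 (hit≡0⇒form≡ a≢κr _ P₀ cut≡0)

    cut-injective : ∀ {a} → P₀ ∈ℓ a → ¬ Rich a →
                    ∀ {r r′} → a ≢ κ r → a ≢ κ r′ → cut a r ≡ cut a r′ → r ≡ r′
    cut-injective {a} P₀∈a ¬rich-a {r} {r′} a≢κr a≢κr′ cut≡cut with r ≟ r′
    ... | yes r≡r′ = r≡r′
    ... | no r≢r′  = contradiction
      (concurrent⇒rich Q∈a Q∈κr Q∈κr′ a≢κr a≢κr′ (r≢r′ ∘ κ-injective)) ¬rich-a
      where
      Q : Point
      Q = meet a (κ r) (b (κ r)) P₀
      Q∈a : Q ∈ℓ a
      Q∈a = trans (form-meet-self a (κ r) _ P₀) P₀∈a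
      Q∈κr : Q ∈ℓ κ r
      Q∈κr = form-meet a≢κr _ P₀
      Q∈κr′ : Q ∈ℓ κ r′
      Q∈κr′ = subst (λ t → P₀ +ᵥ t ·ᵥ dir a ∈ℓ κ r′) (sym cut≡cut) (form-meet a≢κr′ _ P₀)

    cut-i≡r*cut-j : ∀ {r} → r ≢ 0# → cut i r ≡ r * cut j r
    cut-i≡r*cut-j {r} r≢0 = *-cancelʳ (form-dir-≢0 (κ≢i r)) (begin
      cut i r * form (κ r) e₁          ≡⟨ hit-spec (κ≢i r) _ P₀ ⟩
      b (κ r) + - form (κ r) P₀        ≡⟨ hit-spec (κ≢j r≢0) _ P₀ ⟨
      cut j r * form (κ r) e₂          ≡⟨ cong (cut j r *_) (form-κ refl) ⟩
      cut j r * (r * form (κ r) e₁)    ≡⟨ solve 3 (λ v r f → v :* (r :* f) := r :* v :* f)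
                                                  refl (cut j r) r _ ⟩
      r * cut j r * form (κ r) e₁      ∎)

    ∏-units≡1 : ∏ units ≡ 1#
    ∏-units≡1 = sym (*-cancelʳ (∏-≢0 (All.tabulate ∈-units⁻)) (begin
      1# * ∏ units
        ≡⟨ *-identityˡ _ ⟩
      ∏ units
        ≡⟨ ∏-cut-i ⟨
      ∏ (map (cut i) units)
        ≡⟨ ∏-map-* id (cut j) (cut i) (All.tabulate (cut-i≡r*cut-j ∘ ∈-units⁻)) ⟩
      ∏ (map id units) * ∏ (map (cut j) units)
        ≡⟨ cong₂ _*_ (cong ∏ (map-id units)) ∏-cut-j ⟩
      ∏ units * ∏ units
        ∎))
      where
      ∏-cut-i : ∏ (map (cut i) units) ≡ ∏ units
      ∏-cut-i = ∏-map-units (cut i) (cut-≢0 (κ≢i _))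
                  (λ _ _ → cut-injective P₀∈i ¬rich-i (κ≢i _) (κ≢i _))
      ∏-cut-j : ∏ (map (cut j) units) ≡ ∏ units
      ∏-cut-j = ∏-map-units (cut j) (λ r≢0 → cut-≢0 (κ≢j r≢0) r≢0)
                  (λ r≢0 r′≢0 → cut-injective P₀∈j ¬rich-j (κ≢j r≢0) (κ≢j r′≢0))

mainTheorem2 : (F : FiniteField) → OddPrimePower (FiniteField.card F) →
    (b : FiniteField.Slope F → FiniteField.Carrier F) →
    (i j : FiniteField.Slope F) → i ≢ j →
    (∃[ P ] (FiniteField.OnLine F P i (b i) × FiniteField.mult F b P ≥ 3))
      ⊎ (∃[ P ] (FiniteField.OnLine F P j (b j) × FiniteField.mult F b P ≥ 3))
mainTheorem2 F odd b i j i≢j with Family.rich? F b i | Family.rich? F b j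
... | yes rich-i | _          = inj₁ rich-i
... | no _       | yes rich-j = inj₂ rich-j
... | no ¬rich-i | no ¬rich-j = ⊥-elim (1≢-1 (begin
    1#        ≡⟨ ∏-units≡1 ⟨
    ∏ units   ≡⟨ ∏-units≡-1 1≢-1 ⟩
    - 1#      ∎))
  where
  open FiniteField F using (1#; -_)
  open Products F
  open Family.TwoPoorLines F b i≢j ¬rich-i ¬rich-j
  1≢-1 : 1# ≢ - 1#
  1≢-1 = odd-card⇒1≢-1 (oddPrimePower⇒odd odd)
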